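{- Let $n\ge 3$, let $T$ be a tree on $n$ vertices and let $G$ be a connected graph on $n$ vertices containing exactly one cycle. Suppose there are $m\ge \lfloor n/2\rfloor+2$ distinct vertices $w_1,\dots,w_m$ of $G$ and distinct vertices $v_1,\dots,v_m$ of $T$ with $G-w_i\cong T-v_i$ for all $i$. Then $G$ has at least $\frac{n}{4}-1$ vertices of degree $1$.
   Context: All graphs are finite and simple. For a graph $X$ and vertex $v$, $X-v$ denotes the graph obtained by deleting $v$ and its incident edges. -}

module Defs where

open import Data.Nat using (ℕ; zero; suc; _+_; _≤_)
open import Data.Bool using (Bool; true; false; if_then_else_)
open import Data.Fin using (Fin; zero; suc; inject₁; fromℕ; punchIn)
open import Data.List using (List; map; allFin)
open import Data.Nat.ListAction using (sum)
open import Data.Empty using (⊥)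
open import Data.Nat using (_≟_)
open import Relation.Nullary using (does)
open import Data.Product using (Σ; ∃; _×_; _,_)
open import Data.Sum using (_⊎_)
open import Relation.Binary.PropositionalEquality using (_≡_)
open import Function.Definitions using (Injective)
open import Function.Bundles using (_↔_; Inverse)

record Graph (n : ℕ) : Set where
  field
    adj    : Fin n → Fin n → Bool
    adj-sym : ∀ i j → adj i j ≡ adj j i
    adj-irrefl : ∀ i → adj i i ≡ false
open Graph public

_─_ : ∀ {k} → Graph (suc k) → Fin (suc k) → Graph k
adj (X ─ v) i j = adj X (punchIn v i) (punchIn v j)
adj-sym (X ─ v) i j = adj-sym X (punchIn v i) (punchIn v j)
adj-irrefl (X ─ v) i = adj-irrefl X (punchIn v i)

_≅_ : ∀ {n} → Graph n → Graph n → Set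
_≅_ {n} X Y = Σ (Fin n ↔ Fin n) λ f →
  ∀ i j → adj Y (Inverse.to f i) (Inverse.to f j) ≡ adj X i j

data Walk {n} (X : Graph n) : Fin n → Fin n → Set where
  here : ∀ {i} → Walk X i i
  step : ∀ {i j k} → adj X i j ≡ true → Walk X j k → Walk X i k

Connected : ∀ {n} → Graph n → Set
Connected X = ∀ i j → Walk X i j

-- A cycle of length l+3: distinct vertices c 0, …, c (l+2) with
-- consecutive ones adjacent and c (l+2) adjacent to c 0.
record Cycle {n} (X : Graph n) : Set where
  field
    len   : ℕ
    vtx   : Fin (suc (suc (suc len))) → Fin n
    vtx-inj : Injective _≡_ _≡_ vtx
    consec : ∀ (i : Fin (suc (suc len))) → adj X (vtx (inject₁ i)) (vtx (suc i)) ≡ true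
    close  : adj X (vtx (fromℕ (suc (suc len)))) (vtx zero) ≡ true
open Cycle public

CycleEdge : ∀ {n} {X : Graph n} → Cycle X → Fin n → Fin n → Set
CycleEdge C u v =
  (∃ λ i → (u ≡ vtx C (inject₁ i) × v ≡ vtx C (suc i))
         ⊎ (v ≡ vtx C (inject₁ i) × u ≡ vtx C (suc i)))
  ⊎ ((u ≡ vtx C (fromℕ _) × v ≡ vtx C zero)
     ⊎ (v ≡ vtx C (fromℕ _) × u ≡ vtx C zero))

-- Two cycles are the same cycle iff they have the same edge set.
SameCycle : ∀ {n} {X : Graph n} → Cycle X → Cycle X → Set
SameCycle C D = ∀ u v → (CycleEdge C u v → CycleEdge D u v) × (CycleEdge D u v → CycleEdge C u v)

IsTree : ∀ {n} → Graph n → Set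
IsTree X = Connected X × (Cycle X → ⊥)

IsUnicyclic : ∀ {n} → Graph n → Set
IsUnicyclic X = Connected X × Σ (Cycle X) λ C → ∀ D → SameCycle C D

degree : ∀ {n} → Graph n → Fin n → ℕ
degree {n} X i = sum (map (λ j → if adj X i j then 1 else 0) (allFin n))

leaves : ∀ {n} → Graph n → ℕ
leaves {n} X = sum (map (λ i → if does (degree X i ≟ 1) then 1 else 0) (allFin n))

{-# OPTIONS --safe #-}
module Submission where

-- Degree counting: a tree on n vertices has degree sum 2(n − 1) and a unicyclic graph 2n, so the
-- cards G − wᵢ ≅ T − vᵢ force deg_G wᵢ = deg_T vᵢ + 1. Writing e(X) = Σₓ (deg x ∸ 2) for the excess,
-- a connected graph has #leaves = 2n − Σ deg + e, so #leaves(G) = e(G) and #leaves(T) = 2 + e(T).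
-- For each i either deg_G wᵢ ≥ 3, which happens for at most e(G) indices, or vᵢ is a leaf of T,
-- which happens for at most 2 + e(T) ≤ 3 + e(T − vᵢ) = 3 + e(G − wᵢ) ≤ 3 + e(G) indices.
-- Hence m ≤ 2 #leaves(G) + 3, and ⌊n/2⌋ + 2 ≤ m gives n ≤ 4 #leaves(G) + 4.

open import Defs
open import Data.Nat using (ℕ; zero; suc; _+_; _*_; _∸_; _≤_; _<_; z≤n; s≤s; _≤?_; _/_; _%_)
open import Data.Nat.Properties
open import Data.Nat.DivMod using (m≡m%n+[m/n]*n; m%n<n)
open import Data.Nat.Tactic.RingSolver using (solve-∀)
open import Data.Nat.ListAction using () renaming (sum to listSum)
open import Data.Fin as Fin using (Fin; zero; suc; punchIn; punchOut; toℕ; inject₁; fromℕ; fromℕ<)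
import Data.Fin.Properties as Finₚ
open import Data.Bool using (Bool; true; false; if_then_else_; _∧_; _∨_; not)
import Data.Bool.Properties as Boolₚ
open import Data.Product using (Σ; ∃; _×_; _,_; proj₁; proj₂)
open import Data.Sum using (_⊎_; inj₁; inj₂)
open import Data.Empty using (⊥; ⊥-elim)
open import Data.List using (map; allFin; tabulate)
import Data.List.Properties as Listₚ
open import Function using (_∘_; id)
open import Function.Bundles using (Inverse)
open import Function.Definitions using (Injective)
open import Relation.Binary.Definitions using (tri<; tri≈; tri>)
open import Relation.Nullary using (Dec; yes; no; does; ¬_; ¬?; contradiction)
open import Relation.Nullary.Decidable using (_×-dec_; _⊎-dec_; dec-true; dec-false)
open import Relation.Binary.PropositionalEquality
open import Algebra.Properties.CommutativeMonoid.Sum +-0-commutativeMonoid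
  using (sum; sum-syntax; sum-cong-≗; sum-remove; sum-replicate-zero; ∑-comm; ∑-distrib-+; ∑-permute)
open import Algebra.Properties.Semiring.Sum +-*-semiring using (*-distribˡ-sum)

𝟙 : Bool → ℕ
𝟙 b = if b then 1 else 0

𝟙-∧ : ∀ x y → 𝟙 (x ∧ y) ≡ 𝟙 x * 𝟙 y
𝟙-∧ false y = refl
𝟙-∧ true  y = sym (+-identityʳ (𝟙 y))

𝟙-∨ : ∀ {x y} → (x ≡ true → y ≡ true → ⊥) → 𝟙 (x ∨ y) ≡ 𝟙 x + 𝟙 y
𝟙-∨ {false}         _    = refl
𝟙-∨ {true} {false} _    = refl
𝟙-∨ {true} {true}  excl = ⊥-elim (excl refl refl)

𝟙-∧-not : ∀ {b e} → (e ≡ true → b ≡ true) → 𝟙 b ≡ 𝟙 (b ∧ not e) + 𝟙 e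
𝟙-∧-not {false} {false} _   = refl
𝟙-∧-not {false} {true}  e⇒b = contradiction (e⇒b refl) λ ()
𝟙-∧-not {true}  {false} _   = refl
𝟙-∧-not {true}  {true}  _   = refl

𝟙-disjoint-≤ : ∀ {a b c} → (a ≡ true → c ≡ true) → (b ≡ true → c ≡ true) →
               (a ≡ true → b ≡ true → ⊥) → 𝟙 a + 𝟙 b ≤ 𝟙 c
𝟙-disjoint-≤ {false} {false} _   _   _    = z≤n
𝟙-disjoint-≤ {true}  {false} a⇒c _   _    = ≤-reflexive (cong 𝟙 (sym (a⇒c refl)))
𝟙-disjoint-≤ {false} {true}  _   b⇒c _    = ≤-reflexive (cong 𝟙 (sym (b⇒c refl)))
𝟙-disjoint-≤ {true}  {true}  _   _   excl = ⊥-elim (excl refl refl)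

δ : ∀ {n} → Fin n → Fin n → ℕ
δ a b = 𝟙 (does (a Fin.≟ b))

δ-refl : ∀ {n} (a : Fin n) → δ a a ≡ 1
δ-refl a = cong 𝟙 (dec-true (a Fin.≟ a) refl)

δ-≢ : ∀ {n} {a b : Fin n} → a ≢ b → δ a b ≡ 0
δ-≢ {a = a} {b} a≢b = cong 𝟙 (dec-false (a Fin.≟ b) a≢b)

sum-mono-≤ : ∀ {n} {f g : Fin n → ℕ} → (∀ i → f i ≤ g i) → sum f ≤ sum g
sum-mono-≤ {zero}  _   = z≤n
sum-mono-≤ {suc n} f≤g = +-mono-≤ (f≤g zero) (sum-mono-≤ (f≤g ∘ suc))

sum-const : ∀ n c → ∑[ i < n ] c ≡ n * c
sum-const zero    c = refl
sum-const (suc n) c = cong (c +_) (sum-const n c)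

summand≤sum : ∀ {n} (f : Fin n → ℕ) i → f i ≤ sum f
summand≤sum {suc n} f i = ≤-trans (m≤m+n (f i) _) (≤-reflexive (sym (sum-remove {i = i} f)))

sum-δ : ∀ {n} (a : Fin n) → ∑[ j < n ] δ a j ≡ 1
sum-δ {suc n} a = begin
  ∑[ j < suc n ] δ a j                ≡⟨ sum-remove {i = a} (δ a) ⟩
  δ a a + ∑[ i < n ] δ a (punchIn a i) ≡⟨ cong₂ _+_ (δ-refl a) (sum-cong-≗ λ i → δ-≢ (Finₚ.punchInᵢ≢i a i ∘ sym)) ⟩
  1 + ∑[ i < n ] 0                    ≡⟨ cong suc (sum-replicate-zero n) ⟩
  1                                   ∎
  where open ≡-Reasoning

sum-δ⊗δ : ∀ {n} (a b : Fin n) → ∑[ i < n ] ∑[ j < n ] (δ a i * δ b j) ≡ 1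
sum-δ⊗δ {n} a b = begin
  ∑[ i < n ] ∑[ j < n ] (δ a i * δ b j) ≡⟨ sum-cong-≗ (λ i → *-distribˡ-sum (δ a i) (δ b)) ⟨
  ∑[ i < n ] (δ a i * ∑[ j < n ] δ b j) ≡⟨ sum-cong-≗ (λ i → trans (cong (δ a i *_) (sum-δ b)) (*-identityʳ (δ a i))) ⟩
  ∑[ i < n ] δ a i                      ≡⟨ sum-δ a ⟩
  1                                     ∎
  where open ≡-Reasoning

-- The terms f (w (suc i)) avoid the entry w 0 of f, so they are reindexed by punchOut.
sum-∘-injective-≤ : ∀ {m n} (f : Fin n → ℕ) (w : Fin m → Fin n) → Injective _≡_ _≡_ w →
                    ∑[ i < m ] f (w i) ≤ sum f
sum-∘-injective-≤ {zero}          f w _     = z≤n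
sum-∘-injective-≤ {suc m} {zero}  f w _     with () ← w zero
sum-∘-injective-≤ {suc m} {suc n} f w w-inj = begin
  f (w zero) + ∑[ i < m ] f (w (suc i))     ≡⟨ cong (f (w zero) +_) (sum-cong-≗ λ i → cong f (Finₚ.punchIn-punchOut (w₀≢ i))) ⟨
  f (w zero) + ∑[ i < m ] f′ (w′ i)         ≤⟨ +-monoʳ-≤ (f (w zero)) (sum-∘-injective-≤ f′ w′ w′-inj) ⟩
  f (w zero) + sum f′                       ≡⟨ sum-remove {i = w zero} f ⟨
  sum f                                     ∎
  where
  open ≤-Reasoning
  f′ : Fin n → ℕ
  f′ i = f (punchIn (w zero) i)
  w₀≢ : ∀ i → w zero ≢ w (suc i)
  w₀≢ i = Finₚ.0≢1+n ∘ w-inj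
  w′ : Fin m → Fin n
  w′ i = punchOut (w₀≢ i)
  w′-inj : Injective _≡_ _≡_ w′
  w′-inj e = Finₚ.suc-injective (w-inj (Finₚ.punchOut-injective (w₀≢ _) (w₀≢ _) e))

listSum-allFin : ∀ {n} (f : Fin n → ℕ) → listSum (map f (allFin n)) ≡ sum f
listSum-allFin f = trans (cong listSum (Listₚ.map-tabulate id f)) (listSum-tabulate f)
  where
  listSum-tabulate : ∀ {n} (g : Fin n → ℕ) → listSum (tabulate g) ≡ sum g
  listSum-tabulate {zero}  g = refl
  listSum-tabulate {suc n} g = cong (g zero +_) (listSum-tabulate (g ∘ suc))

deg : ∀ {n} → Graph n → Fin n → ℕ
deg {n} X i = ∑[ j < n ] 𝟙 (adj X i j)

degree≡deg : ∀ {n} (X : Graph n) i → degree X i ≡ deg X i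
degree≡deg X i = listSum-allFin (λ j → 𝟙 (adj X i j))

degreeSum : ∀ {n} → Graph n → ℕ
degreeSum {n} X = ∑[ i < n ] deg X i

adj⇒deg-pos : ∀ {n} (X : Graph n) {i j} → adj X i j ≡ true → 1 ≤ deg X i
adj⇒deg-pos X {i} {j} e = ≤-trans (≤-reflexive (cong 𝟙 (sym e))) (summand≤sum (λ j → 𝟙 (adj X i j)) j)

deg-punchIn : ∀ {k} (X : Graph (suc k)) v i →
              deg X (punchIn v i) ≡ 𝟙 (adj X (punchIn v i) v) + deg (X ─ v) i
deg-punchIn X v i = sum-remove {i = v} (λ j → 𝟙 (adj X (punchIn v i) j))

deg-via-punchIn : ∀ {k} (X : Graph (suc k)) v → deg X v ≡ ∑[ i < k ] 𝟙 (adj X (punchIn v i) v)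
deg-via-punchIn X v = begin
  deg X v                                              ≡⟨ sum-remove {i = v} (λ j → 𝟙 (adj X v j)) ⟩
  𝟙 (adj X v v) + ∑[ i < _ ] 𝟙 (adj X v (punchIn v i)) ≡⟨ cong₂ _+_ (cong 𝟙 (adj-irrefl X v))
                                                                  (sum-cong-≗ λ i → cong 𝟙 (adj-sym X v (punchIn v i))) ⟩
  ∑[ i < _ ] 𝟙 (adj X (punchIn v i) v)                 ∎
  where open ≡-Reasoning

degreeSum-─ : ∀ {k} (X : Graph (suc k)) v → degreeSum X ≡ degreeSum (X ─ v) + 2 * deg X v
degreeSum-─ {k} X v = begin
  degreeSum X                                                    ≡⟨ sum-remove {i = v} (deg X) ⟩
  deg X v + ∑[ i < k ] deg X (punchIn v i)                       ≡⟨ cong (deg X v +_) (sum-cong-≗ (deg-punchIn X v)) ⟩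
  deg X v + ∑[ i < k ] (𝟙 (adj X (punchIn v i) v) + deg (X ─ v) i) ≡⟨ cong (deg X v +_) (∑-distrib-+ _ (deg (X ─ v))) ⟩
  deg X v + (∑[ i < k ] 𝟙 (adj X (punchIn v i) v) + degreeSum (X ─ v))
                                                                 ≡⟨ cong (λ d → deg X v + (d + degreeSum (X ─ v))) (deg-via-punchIn X v) ⟨
  deg X v + (deg X v + degreeSum (X ─ v))                        ≡⟨ rearrange (deg X v) (degreeSum (X ─ v)) ⟩
  degreeSum (X ─ v) + 2 * deg X v                                ∎
  where
  open ≡-Reasoning
  rearrange : ∀ d s → d + (d + s) ≡ s + 2 * d
  rearrange = solve-∀

deg-≅ : ∀ {n} {X Y : Graph n} ((π , pres) : X ≅ Y) i → deg Y (Inverse.to π i) ≡ deg X i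
deg-≅ {X = X} {Y} (π , pres) i =
  trans (∑-permute (λ j → 𝟙 (adj Y (Inverse.to π i) j)) π) (sum-cong-≗ (cong 𝟙 ∘ pres i))

sum-deg-≅ : ∀ {n} {X Y : Graph n} → X ≅ Y → (g : ℕ → ℕ) → ∑[ i < n ] g (deg Y i) ≡ ∑[ i < n ] g (deg X i)
sum-deg-≅ {X = X} {Y} iso@(π , _) g = trans (∑-permute (g ∘ deg Y) π) (sum-cong-≗ (cong g ∘ deg-≅ {X = X} {Y} iso))

degreeSum-≅ : ∀ {n} {X Y : Graph n} → X ≅ Y → degreeSum X ≡ degreeSum Y
degreeSum-≅ {X = X} {Y} iso = sym (sum-deg-≅ {X = X} {Y} iso id)

-- Connected graphs: at least n - 1 edges

least-witness : (P : ℕ → Set) → (∀ t → Dec (P t)) → ∀ {t} → P t →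
                Σ ℕ λ s → P s × (∀ r → r < s → ¬ P r)
least-witness P P? {zero}  p = zero , p , λ _ ()
least-witness P P? {suc t} p with P? zero
... | yes p₀ = zero , p₀ , λ _ ()
... | no ¬p₀ with least-witness (P ∘ suc) (P? ∘ suc) p
...   | s , pₛ , below = suc s , pₛ , λ { zero _ → ¬p₀ ; (suc r) (s≤s r<s) → below r r<s }

-- Each vertex other than the root points to a neighbour strictly closer to the root; the
-- edges x — parent x are pairwise distinct, which gives k edges.
module ParentMap {k} (X : Graph (suc k)) (conn : Connected X) where

  root : Fin (suc k)
  root = zero

  WithinDist : ℕ → Fin (suc k) → Set
  WithinDist zero    x = x ≡ root
  WithinDist (suc t) x = WithinDist t x ⊎ ∃ λ y → adj X x y ≡ true × WithinDist t y

  withinDist? : ∀ t x → Dec (WithinDist t x)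
  withinDist? zero    x = x Fin.≟ root
  withinDist? (suc t) x = withinDist? t x ⊎-dec Finₚ.any? (λ y → (adj X x y Boolₚ.≟ true) ×-dec withinDist? t y)

  walk⇒withinDist : ∀ {x} → Walk X x root → ∃ λ t → WithinDist t x
  walk⇒withinDist here       = zero , refl
  walk⇒withinDist (step e w) = let (t , d) = walk⇒withinDist w in suc t , inj₂ (_ , e , d)

  minDist : ∀ x → Σ ℕ λ t → WithinDist t x × (∀ s → s < t → ¬ WithinDist s x)
  minDist x = least-witness (λ t → WithinDist t x) (λ t → withinDist? t x) (proj₂ (walk⇒withinDist (conn x root)))

  dist : Fin (suc k) → ℕ
  dist x = proj₁ (minDist x)

  dist-≤ : ∀ {t x} → WithinDist t x → dist x ≤ t
  dist-≤ {t} {x} d with dist x ≤? t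
  ... | yes ≤t = ≤t
  ... | no  ≰t = contradiction d (proj₂ (proj₂ (minDist x)) t (≰⇒> ≰t))

  closer-neighbour : ∀ x → x ≢ root → ∃ λ y → adj X x y ≡ true × dist y < dist x
  closer-neighbour x x≢root with minDist x
  ... | zero  , x≡root          , _     = contradiction x≡root x≢root
  ... | suc t , inj₁ d          , below = contradiction d (below t ≤-refl)
  ... | suc t , inj₂ (y , e , d) , _    = y , e , s≤s (dist-≤ d)

  parent : Fin (suc k) → Fin (suc k)
  parent x with x Fin.≟ root
  ... | yes _      = root
  ... | no  x≢root = proj₁ (closer-neighbour x x≢root)

  parent-closer : ∀ x → x ≢ root → adj X x (parent x) ≡ true × dist (parent x) < dist x
  parent-closer x x≢root with x Fin.≟ root
  ... | yes x≡root = contradiction x≡root x≢root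
  ... | no  x≢root = proj₂ (closer-neighbour x x≢root)

  isParentEdge : Fin (suc k) → Fin (suc k) → Bool
  isParentEdge x y = not (does (root Fin.≟ x)) ∧ does (parent x Fin.≟ y)

  isParentEdge-true : ∀ {x y} → isParentEdge x y ≡ true → x ≢ root × parent x ≡ y
  isParentEdge-true {x} {y} _ with root Fin.≟ x | parent x Fin.≟ y
  ... | no root≢x | yes px≡y = root≢x ∘ sym , px≡y
  isParentEdge-true () | yes _ | _
  isParentEdge-true () | no _  | no _

  parentEdge-adj : ∀ {x y} → isParentEdge x y ≡ true → adj X x y ≡ true
  parentEdge-adj {x} {y} p with x≢root , refl ← isParentEdge-true {x} {y} p = proj₁ (parent-closer x x≢root)

  parentEdge-closer : ∀ {x y} → isParentEdge x y ≡ true → dist y < dist x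
  parentEdge-closer {x} {y} p with x≢root , refl ← isParentEdge-true {x} {y} p = proj₂ (parent-closer x x≢root)

  parentEdges-≤-adj : ∀ x y → 𝟙 (isParentEdge x y) + 𝟙 (isParentEdge y x) ≤ 𝟙 (adj X x y)
  parentEdges-≤-adj x y =
    𝟙-disjoint-≤ (parentEdge-adj {x} {y}) (λ q → trans (adj-sym X x y) (parentEdge-adj {y} {x} q))
                 (λ p q → <-asym (parentEdge-closer {x} {y} p) (parentEdge-closer {y} {x} q))

  isNonRoot : Fin (suc k) → ℕ
  isNonRoot x = 𝟙 (not (does (root Fin.≟ x)))

  sum-isParentEdge : ∀ x → ∑[ y < suc k ] 𝟙 (isParentEdge x y) ≡ isNonRoot x
  sum-isParentEdge x = begin
    ∑[ y < suc k ] 𝟙 (isParentEdge x y)          ≡⟨ sum-cong-≗ (λ y → 𝟙-∧ (not (does (root Fin.≟ x))) (does (parent x Fin.≟ y))) ⟩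
    ∑[ y < suc k ] (isNonRoot x * δ (parent x) y) ≡⟨ *-distribˡ-sum (isNonRoot x) (δ (parent x)) ⟨
    isNonRoot x * ∑[ y < suc k ] δ (parent x) y   ≡⟨ cong (isNonRoot x *_) (sum-δ (parent x)) ⟩
    isNonRoot x * 1                               ≡⟨ *-identityʳ (isNonRoot x) ⟩
    isNonRoot x                                   ∎
    where open ≡-Reasoning

  sum-isNonRoot : ∑[ x < suc k ] isNonRoot x ≡ k
  sum-isNonRoot = begin
    ∑[ x < suc k ] isNonRoot x                 ≡⟨ cong₂ _+_ (cong (𝟙 ∘ not) (dec-true (root Fin.≟ root) refl))
                                                             (sum-cong-≗ λ i → cong (𝟙 ∘ not) (dec-false (root Fin.≟ suc i) λ ())) ⟩
    ∑[ i < k ] 1                               ≡⟨ sum-const k 1 ⟩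
    k * 1                                      ≡⟨ *-identityʳ k ⟩
    k                                          ∎
    where open ≡-Reasoning

  parentEdge-count : ∑[ x < suc k ] ∑[ y < suc k ] 𝟙 (isParentEdge x y) ≡ k
  parentEdge-count = trans (sum-cong-≗ sum-isParentEdge) sum-isNonRoot

  2k≤degreeSum : 2 * k ≤ degreeSum X
  2k≤degreeSum = begin
    2 * k
      ≡⟨ cong (k +_) (+-identityʳ k) ⟩
    k + k
      ≡⟨ cong₂ _+_ parentEdge-count (trans (∑-comm (λ x y → p y x)) parentEdge-count) ⟨
    ∑[ x < suc k ] ∑[ y < suc k ] p x y + ∑[ x < suc k ] ∑[ y < suc k ] p y x
      ≡⟨ ∑-distrib-+ (λ x → sum (p x)) (λ x → ∑[ y < suc k ] p y x) ⟨
    ∑[ x < suc k ] (∑[ y < suc k ] p x y + ∑[ y < suc k ] p y x)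
      ≡⟨ sum-cong-≗ (λ x → ∑-distrib-+ (p x) (λ y → p y x)) ⟨
    ∑[ x < suc k ] ∑[ y < suc k ] (p x y + p y x)
      ≤⟨ sum-mono-≤ (λ x → sum-mono-≤ (parentEdges-≤-adj x)) ⟩
    degreeSum X
      ∎
    where
    open ≤-Reasoning
    p : Fin (suc k) → Fin (suc k) → ℕ
    p x y = 𝟙 (isParentEdge x y)

connected⇒2k≤degreeSum : ∀ {k} (X : Graph (suc k)) → Connected X → 2 * k ≤ degreeSum X
connected⇒2k≤degreeSum X conn = ParentMap.2k≤degreeSum X conn

-- Acyclic graphs: at most n - 1 edges

other-neighbour : ∀ {n} (X : Graph n) u p → 2 ≤ deg X u → ∃ λ y → adj X u y ≡ true × y ≢ p
other-neighbour X u p 2≤deg with Finₚ.any? (λ y → (adj X u y Boolₚ.≟ true) ×-dec ¬? (y Fin.≟ p))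
... | yes found = found
... | no  none  = contradiction (≤-trans (sum-mono-≤ adj≤δ) (≤-reflexive (sum-δ p))) (<⇒≱ 2≤deg)
  where
  adj≤δ : ∀ y → 𝟙 (adj X u y) ≤ δ p y
  adj≤δ y with adj X u y in e | p Fin.≟ y
  ... | false | _        = z≤n
  ... | true  | yes _    = ≤-refl
  ... | true  | no  p≢y = contradiction (y , e , p≢y ∘ sym) none

record NonBacktrackingWalk {n} (X : Graph n) : Set where
  field
    vertex       : ℕ → Fin n
    vertex-adj   : ∀ t → adj X (vertex t) (vertex (suc t)) ≡ true
    no-backtrack : ∀ t → vertex (suc (suc t)) ≢ vertex t

minDeg≥2⇒nonBacktrackingWalk : ∀ {k} (X : Graph (suc k)) → (∀ u → 2 ≤ deg X u) → NonBacktrackingWalk X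
minDeg≥2⇒nonBacktrackingWalk {k} X 2≤deg = record
  { vertex       = proj₁ ∘ arc
  ; vertex-adj   = arc-adj
  ; no-backtrack = λ t → proj₂ (proj₂ (next (proj₂ (arc t)) (proj₁ (arc t))))
  }
  where
  next : ∀ u p → ∃ λ y → adj X u y ≡ true × y ≢ p
  next u p = other-neighbour X u p (2≤deg u)
  arc : ℕ → Fin (suc k) × Fin (suc k)
  arc zero    = zero , proj₁ (next zero zero)
  arc (suc t) = proj₂ (arc t) , proj₁ (next (proj₂ (arc t)) (proj₁ (arc t)))
  arc-adj : ∀ t → adj X (proj₁ (arc t)) (proj₂ (arc t)) ≡ true
  arc-adj zero    = proj₁ (proj₂ (next zero zero))
  arc-adj (suc t) = proj₁ (proj₂ (next (proj₂ (arc t)) (proj₁ (arc t))))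

-- The first vertex to be revisited, say vertex a = vertex b with a < b minimal in b, closes a cycle
-- vertex a, …, vertex (b - 1); it has length ≥ 3 since X is loopless and the walk never backtracks.
module FirstRepetition {n} {X : Graph n} (W : NonBacktrackingWalk X) where
  open NonBacktrackingWalk W

  Revisits : ℕ → Set
  Revisits b = Σ (Fin b) λ a → vertex (toℕ a) ≡ vertex b

  some-revisit : ∃ Revisits
  some-revisit with i , j , i<j , vᵢ≡vⱼ ← Finₚ.pigeonhole (n<1+n n) (vertex ∘ toℕ) =
    toℕ j , fromℕ< i<j , trans (cong vertex (Finₚ.toℕ-fromℕ< i<j)) vᵢ≡vⱼ

  first-revisit : Σ ℕ λ b → Revisits b × (∀ c → c < b → ¬ Revisits c)
  first-revisit = least-witness Revisits (λ b → Finₚ.any? (λ a → vertex (toℕ a) Fin.≟ vertex b)) (proj₂ some-revisit)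

  b : ℕ
  b = proj₁ first-revisit

  a : ℕ
  a = toℕ (proj₁ (proj₁ (proj₂ first-revisit)))

  a<b : a < b
  a<b = Finₚ.toℕ<n (proj₁ (proj₁ (proj₂ first-revisit)))

  va≡vb : vertex a ≡ vertex b
  va≡vb = proj₂ (proj₁ (proj₂ first-revisit))

  distinct-before-b : ∀ {i j} → i < j → j < b → vertex i ≢ vertex j
  distinct-before-b i<j j<b vᵢ≡vⱼ =
    proj₂ (proj₂ first-revisit) _ j<b (fromℕ< i<j , trans (cong vertex (Finₚ.toℕ-fromℕ< i<j)) vᵢ≡vⱼ)

  cycleOfLength : ∀ l → b ≡ a + suc (suc (suc l)) → Cycle X
  cycleOfLength l b≡ = record
    { len     = l
    ; vtx     = c
    ; vtx-inj = c-inj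
    ; consec  = λ i → subst₂ (λ s t → adj X (vertex s) (vertex t) ≡ true)
                        (cong (a +_) (sym (Finₚ.toℕ-inject₁ i))) (sym (+-suc a (toℕ i))) (vertex-adj (a + toℕ i))
    ; close   = subst₂ (λ s u → adj X (vertex s) u ≡ true)
                  (cong (a +_) (sym (Finₚ.toℕ-fromℕ (suc (suc l)))))
                  (begin
                    vertex (suc (a + suc (suc l))) ≡⟨ cong vertex (trans b≡ (+-suc a (suc (suc l)))) ⟨
                    vertex b                        ≡⟨ va≡vb ⟨
                    vertex a                        ≡⟨ cong vertex (+-identityʳ a) ⟨
                    vertex (a + 0)                  ∎)
                  (vertex-adj (a + suc (suc l)))
    }
    where
    open ≡-Reasoning
    c : Fin (suc (suc (suc l))) → Fin n
    c i = vertex (a + toℕ i)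
    a+i<b : ∀ i → a + toℕ i < b
    a+i<b i = subst (a + toℕ i <_) (sym b≡) (+-monoʳ-< a (Finₚ.toℕ<n i))
    c-inj : Injective _≡_ _≡_ c
    c-inj {i} {j} cᵢ≡cⱼ with <-cmp (toℕ i) (toℕ j)
    ... | tri< i<j _ _ = contradiction cᵢ≡cⱼ (distinct-before-b (+-monoʳ-< a i<j) (a+i<b j))
    ... | tri≈ _ i≡j _ = Finₚ.toℕ-injective i≡j
    ... | tri> _ _ i>j = contradiction (sym cᵢ≡cⱼ) (distinct-before-b (+-monoʳ-< a i>j) (a+i<b i))

  cycle : Cycle X
  cycle with m≤n⇒∃[o]m+o≡n a<b
  ... | zero , a+1≡b = contradiction (trans (sym (adj-irrefl X (vertex a))) loop) λ ()
    where
    loop : adj X (vertex a) (vertex a) ≡ true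
    loop = subst (λ u → adj X (vertex a) u ≡ true)
             (trans (cong vertex (trans (sym (+-identityʳ (suc a))) a+1≡b)) (sym va≡vb)) (vertex-adj a)
  ... | suc zero , a+2≡b = contradiction (trans (cong vertex (trans (cong suc (+-comm 1 a)) a+2≡b)) (sym va≡vb)) (no-backtrack a)
  ... | suc (suc l) , a+l+3≡b = cycleOfLength l (trans (sym a+l+3≡b) (sym (+-suc a (suc (suc l)))))

acyclic⇒leaf : ∀ {k} (X : Graph (suc k)) → (Cycle X → ⊥) → ∃ λ v → deg X v ≤ 1
acyclic⇒leaf X acyclic with Finₚ.any? (λ v → deg X v ≤? 1)
... | yes leaf    = leaf
... | no  no-leaf = ⊥-elim (acyclic (FirstRepetition.cycle (minDeg≥2⇒nonBacktrackingWalk X 2≤deg)))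
  where
  2≤deg : ∀ u → 2 ≤ deg X u
  2≤deg u = ≰⇒> (no-leaf ∘ (u ,_))

lift-cycle : ∀ {k} (X : Graph (suc k)) v → Cycle (X ─ v) → Cycle X
lift-cycle X v C = record
  { len     = len C
  ; vtx     = punchIn v ∘ vtx C
  ; vtx-inj = vtx-inj C ∘ Finₚ.punchIn-injective v _ _
  ; consec  = consec C
  ; close   = close C
  }

2k+2≡2[1+k] : ∀ k → 2 * k + 2 ≡ 2 * suc k
2k+2≡2[1+k] = solve-∀

acyclic⇒degreeSum≤2k : ∀ k (X : Graph (suc k)) → (Cycle X → ⊥) → degreeSum X ≤ 2 * k
acyclic⇒degreeSum≤2k zero    X _ rewrite adj-irrefl X zero = z≤n
acyclic⇒degreeSum≤2k (suc k) X acyclic with v , deg≤1 ← acyclic⇒leaf X acyclic = begin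
  degreeSum X                     ≡⟨ degreeSum-─ X v ⟩
  degreeSum (X ─ v) + 2 * deg X v ≤⟨ +-mono-≤ (acyclic⇒degreeSum≤2k k (X ─ v) (acyclic ∘ lift-cycle X v)) (*-monoʳ-≤ 2 deg≤1) ⟩
  2 * k + 2                       ≡⟨ 2k+2≡2[1+k] k ⟩
  2 * suc k                       ∎
  where open ≤-Reasoning

tree⇒degreeSum≡2k : ∀ {k} (X : Graph (suc k)) → IsTree X → degreeSum X ≡ 2 * k
tree⇒degreeSum≡2k {k} X (conn , acyclic) = ≤-antisym (acyclic⇒degreeSum≤2k k X acyclic) (connected⇒2k≤degreeSum X conn)

-- Unicyclic graphs: exactly n edges

isEdge : ∀ {n} → Fin n → Fin n → Fin n → Fin n → Bool
isEdge a b i j = (does (a Fin.≟ i) ∧ does (b Fin.≟ j)) ∨ (does (b Fin.≟ i) ∧ does (a Fin.≟ j))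

isEdge-sym : ∀ {n} (a b i j : Fin n) → isEdge a b i j ≡ isEdge a b j i
isEdge-sym a b i j = trans (cong₂ _∨_ (Boolₚ.∧-comm (does (a Fin.≟ i)) _) (Boolₚ.∧-comm (does (b Fin.≟ i)) _))
                           (Boolₚ.∨-comm (does (b Fin.≟ j) ∧ does (a Fin.≟ i)) _)

isEdge-true : ∀ {n} {a b i j : Fin n} → isEdge a b i j ≡ true → (a ≡ i × b ≡ j) ⊎ (b ≡ i × a ≡ j)
isEdge-true {a = a} {b} {i} {j} e with a Fin.≟ i | b Fin.≟ j | b Fin.≟ i | a Fin.≟ j
... | yes a≡i | yes b≡j | _       | _       = inj₁ (a≡i , b≡j)
... | _       | _       | yes b≡i | yes a≡j = inj₂ (b≡i , a≡j)
isEdge-true () | yes _ | no _  | yes _ | no _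
isEdge-true () | yes _ | no _  | no _  | _
isEdge-true () | no _  | _     | yes _ | no _
isEdge-true () | no _  | _     | no _  | _

isEdge-self : ∀ {n} (a b : Fin n) → isEdge a b a b ≡ true
isEdge-self a b rewrite dec-true (a Fin.≟ a) refl | dec-true (b Fin.≟ b) refl = refl

deleteEdge : ∀ {n} → Graph n → Fin n → Fin n → Graph n
adj        (deleteEdge X a b) i j = adj X i j ∧ not (isEdge a b i j)
adj-sym    (deleteEdge X a b) i j = cong₂ (λ e f → e ∧ not f) (adj-sym X i j) (isEdge-sym a b i j)
adj-irrefl (deleteEdge X a b) i rewrite adj-irrefl X i = refl

deleteEdge-⊆ : ∀ {n} (X : Graph n) a b {i j} → adj (deleteEdge X a b) i j ≡ true → adj X i j ≡ true
deleteEdge-⊆ X a b {i} {j} e with adj X i j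
... | true = refl

deleteEdge-keeps : ∀ {n} (X : Graph n) a b {i j} → isEdge a b i j ≡ false → adj (deleteEdge X a b) i j ≡ adj X i j
deleteEdge-keeps X a b {i} {j} e rewrite e = Boolₚ.∧-identityʳ (adj X i j)

deleteEdge-removes : ∀ {n} (X : Graph n) a b → adj (deleteEdge X a b) a b ≡ false
deleteEdge-removes X a b rewrite isEdge-self a b = Boolₚ.∧-zeroʳ (adj X a b)

sum-isEdge : ∀ {n} {a b : Fin n} → a ≢ b → ∑[ i < n ] ∑[ j < n ] 𝟙 (isEdge a b i j) ≡ 2
sum-isEdge {n} {a} {b} a≢b = begin
  ∑[ i < n ] ∑[ j < n ] 𝟙 (isEdge a b i j)
    ≡⟨ sum-cong-≗ (λ i → sum-cong-≗ (split i)) ⟩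
  ∑[ i < n ] ∑[ j < n ] (δ a i * δ b j + δ b i * δ a j)
    ≡⟨ sum-cong-≗ (λ i → ∑-distrib-+ (λ j → δ a i * δ b j) (λ j → δ b i * δ a j)) ⟩
  ∑[ i < n ] (∑[ j < n ] (δ a i * δ b j) + ∑[ j < n ] (δ b i * δ a j))
    ≡⟨ ∑-distrib-+ (λ i → ∑[ j < n ] (δ a i * δ b j)) (λ i → ∑[ j < n ] (δ b i * δ a j)) ⟩
  ∑[ i < n ] ∑[ j < n ] (δ a i * δ b j) + ∑[ i < n ] ∑[ j < n ] (δ b i * δ a j)
    ≡⟨ cong₂ _+_ (sum-δ⊗δ a b) (sum-δ⊗δ b a) ⟩
  2
    ∎
  where
  open ≡-Reasoning
  split : ∀ i j → 𝟙 (isEdge a b i j) ≡ δ a i * δ b j + δ b i * δ a j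
  split i j = trans (𝟙-∨ excl) (cong₂ _+_ (𝟙-∧ (does (a Fin.≟ i)) _) (𝟙-∧ (does (b Fin.≟ i)) _))
    where
    excl : does (a Fin.≟ i) ∧ does (b Fin.≟ j) ≡ true → does (b Fin.≟ i) ∧ does (a Fin.≟ j) ≡ true → ⊥
    excl p q with a Fin.≟ i | b Fin.≟ i
    ... | yes a≡i | yes b≡i = a≢b (trans a≡i (sym b≡i))
    excl () _ | no _ | _
    excl _ () | yes _ | no _

degreeSum-deleteEdge : ∀ {n} (X : Graph n) {a b} → a ≢ b → adj X a b ≡ true →
                       degreeSum X ≡ degreeSum (deleteEdge X a b) + 2
degreeSum-deleteEdge {n} X {a} {b} a≢b ab = begin
  degreeSum X
    ≡⟨ sum-cong-≗ (λ i → sum-cong-≗ (λ j → 𝟙-∧-not (edge⇒adj i j))) ⟩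
  ∑[ i < n ] ∑[ j < n ] (𝟙 (adj X′ i j) + 𝟙 (isEdge a b i j))
    ≡⟨ sum-cong-≗ (λ i → ∑-distrib-+ (λ j → 𝟙 (adj X′ i j)) (λ j → 𝟙 (isEdge a b i j))) ⟩
  ∑[ i < n ] (deg X′ i + ∑[ j < n ] 𝟙 (isEdge a b i j))
    ≡⟨ ∑-distrib-+ (deg X′) (λ i → ∑[ j < n ] 𝟙 (isEdge a b i j)) ⟩
  degreeSum X′ + ∑[ i < n ] ∑[ j < n ] 𝟙 (isEdge a b i j)
    ≡⟨ cong (degreeSum X′ +_) (sum-isEdge a≢b) ⟩
  degreeSum X′ + 2
    ∎
  where
  open ≡-Reasoning
  X′ : Graph n
  X′ = deleteEdge X a b
  edge⇒adj : ∀ i j → isEdge a b i j ≡ true → adj X i j ≡ true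
  edge⇒adj i j e with isEdge-true {a = a} {b} {i} {j} e
  ... | inj₁ (refl , refl) = ab
  ... | inj₂ (refl , refl) = trans (adj-sym X b a) ab

_++ʷ_ : ∀ {n} {X : Graph n} {i j l} → Walk X i j → Walk X j l → Walk X i l
here       ++ʷ w′ = w′
step e w ++ʷ w′ = step e (w ++ʷ w′)

reverseʷ : ∀ {n} {X : Graph n} {i j} → Walk X i j → Walk X j i
reverseʷ here                         = here
reverseʷ {X = X} (step {i} {j} e w) = reverseʷ w ++ʷ step (trans (adj-sym X j i) e) here

walk-along : ∀ {n} (X : Graph n) N (c : Fin (suc N) → Fin n) →
             (∀ i → adj X (c (inject₁ i)) (c (suc i)) ≡ true) → Walk X (c zero) (c (fromℕ N))
walk-along X zero    c c-adj = here
walk-along X (suc N) c c-adj = step (c-adj zero) (walk-along X N (c ∘ suc) (c-adj ∘ suc))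

cycleEdge-adj : ∀ {n} {X : Graph n} (C : Cycle X) {u v} → CycleEdge C u v → adj X u v ≡ true
cycleEdge-adj C           (inj₁ (i , inj₁ (refl , refl))) = consec C i
cycleEdge-adj {X = X} C (inj₁ (i , inj₂ (refl , refl))) = trans (adj-sym X _ _) (consec C i)
cycleEdge-adj C           (inj₂ (inj₁ (refl , refl)))     = close C
cycleEdge-adj {X = X} C (inj₂ (inj₂ (refl , refl)))     = trans (adj-sym X _ _) (close C)

-- Deleting the closing edge a — b of the unique cycle leaves a tree: the cycle itself
-- reroutes every walk through a — b, and a cycle avoiding a — b would be a second cycle.
module DeleteCycleEdge {k} (G : Graph (suc k)) (uni : IsUnicyclic G) where

  C : Cycle G
  C = proj₁ (proj₂ uni)

  a b : Fin (suc k)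
  a = vtx C (fromℕ (suc (suc (len C))))
  b = vtx C zero

  a≢b : a ≢ b
  a≢b = (λ ()) ∘ vtx-inj C

  T′ : Graph (suc k)
  T′ = deleteEdge G a b

  acyclic : Cycle T′ → ⊥
  acyclic D = contradiction (trans (sym (deleteEdge-removes G a b)) (cycleEdge-adj D ab∈D)) λ ()
    where
    D-in-G : Cycle G
    D-in-G = record { len = len D ; vtx = vtx D ; vtx-inj = vtx-inj D
                    ; consec = deleteEdge-⊆ G a b ∘ consec D ; close = deleteEdge-⊆ G a b (close D) }
    ab∈D : CycleEdge D a b
    ab∈D = proj₁ (proj₂ (proj₂ uni) D-in-G a b) (inj₂ (inj₁ (refl , refl)))

  cycle-path-avoids-ab : ∀ i → isEdge a b (vtx C (inject₁ i)) (vtx C (suc i)) ≡ false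
  cycle-path-avoids-ab i with isEdge a b (vtx C (inject₁ i)) (vtx C (suc i)) in e
  ... | false = refl
  ... | true with isEdge-true {a = a} {b} e
  ...   | inj₁ (a≡ , _)   = contradiction (vtx-inj C a≡) Finₚ.fromℕ≢inject₁
  ...   | inj₂ (b≡ , a≡) = ⊥-elim (wraps-once i (vtx-inj C b≡) (vtx-inj C a≡))
    where
    wraps-once : ∀ {l} (j : Fin (suc (suc l))) → zero ≡ inject₁ j → fromℕ (suc (suc l)) ≢ suc j
    wraps-once zero    _  ()
    wraps-once (suc j) ()

  walk-b-a : Walk T′ b a
  walk-b-a = walk-along T′ (suc (suc (len C))) (vtx C)
               (λ i → trans (deleteEdge-keeps G a b (cycle-path-avoids-ab i)) (consec C i))

  reroute : ∀ {x y} → Walk G x y → Walk T′ x y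
  reroute here = here
  reroute (step {x} {j} e w) with isEdge a b x j in isE
  ... | false = step (trans (deleteEdge-keeps G a b isE) e) (reroute w)
  ... | true with isEdge-true {a = a} {b} isE
  ...   | inj₁ (refl , refl) = reverseʷ walk-b-a ++ʷ reroute w
  ...   | inj₂ (refl , refl) = walk-b-a ++ʷ reroute w

  tree : IsTree T′
  tree = (λ x y → reroute (proj₁ uni x y)) , acyclic

unicyclic⇒degreeSum≡2n : ∀ {k} (G : Graph (suc k)) → IsUnicyclic G → degreeSum G ≡ 2 * suc k
unicyclic⇒degreeSum≡2n {k} G uni = begin
  degreeSum G      ≡⟨ degreeSum-deleteEdge G a≢b (close C) ⟩
  degreeSum T′ + 2 ≡⟨ cong (_+ 2) (tree⇒degreeSum≡2k T′ tree) ⟩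
  2 * k + 2        ≡⟨ 2k+2≡2[1+k] k ⟩
  2 * suc k        ∎
  where
  open ≡-Reasoning
  open DeleteCycleEdge G uni

excess : ∀ {n} → Graph n → ℕ
excess {n} X = ∑[ x < n ] (deg X x ∸ 2)

leafCount : ∀ {n} → Graph n → ℕ
leafCount {n} X = ∑[ x < n ] 𝟙 (does (deg X x ≟ 1))

leaves≡leafCount : ∀ {n} (X : Graph n) → leaves X ≡ leafCount X
leaves≡leafCount X = trans (listSum-allFin (λ x → 𝟙 (does (degree X x ≟ 1))))
                           (sum-cong-≗ λ x → cong (λ d → 𝟙 (does (d ≟ 1))) (degree≡deg X x))

connected⇒deg-pos : ∀ {k} (X : Graph (suc (suc k))) → Connected X → ∀ x → 1 ≤ deg X x
connected⇒deg-pos X conn x = first-step (conn x (punchIn x zero)) (Finₚ.punchInᵢ≢i x zero ∘ sym)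
  where
  first-step : ∀ {y} → Walk X x y → x ≢ y → 1 ≤ deg X x
  first-step here       x≢x = contradiction refl x≢x
  first-step (step e _) _   = adj⇒deg-pos X e

degreeSum+leafCount : ∀ {k} (X : Graph (suc (suc k))) → Connected X →
                      degreeSum X + leafCount X ≡ 2 * suc (suc k) + excess X
degreeSum+leafCount {k} X conn = begin
  degreeSum X + leafCount X                    ≡⟨ ∑-distrib-+ (deg X) (λ x → 𝟙 (does (deg X x ≟ 1))) ⟨
  ∑[ x < n ] (deg X x + 𝟙 (does (deg X x ≟ 1))) ≡⟨ sum-cong-≗ (λ x → pointwise (deg X x) (connected⇒deg-pos X conn x)) ⟩
  ∑[ x < n ] (2 + (deg X x ∸ 2))               ≡⟨ ∑-distrib-+ (λ _ → 2) (λ x → deg X x ∸ 2) ⟩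
  ∑[ x < n ] 2 + excess X                      ≡⟨ cong (_+ excess X) (trans (sum-const n 2) (*-comm n 2)) ⟩
  2 * n + excess X                             ∎
  where
  open ≡-Reasoning
  n : ℕ
  n = suc (suc k)
  pointwise : ∀ d → 1 ≤ d → d + 𝟙 (does (d ≟ 1)) ≡ 2 + (d ∸ 2)
  pointwise (suc zero)    _ = refl
  pointwise (suc (suc d)) _ = +-identityʳ (suc (suc d))

excess-≅ : ∀ {n} {X Y : Graph n} → X ≅ Y → excess X ≡ excess Y
excess-≅ {X = X} {Y} iso = sym (sum-deg-≅ {X = X} {Y} iso (_∸ 2))

excess-─-≤ : ∀ {k} (X : Graph (suc k)) v → excess (X ─ v) ≤ excess X
excess-─-≤ {k} X v = begin
  excess (X ─ v)                                         ≤⟨ sum-mono-≤ (λ i → ∸-monoˡ-≤ 2 (deg-─-≤ i)) ⟩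
  ∑[ i < k ] (deg X (punchIn v i) ∸ 2)                    ≤⟨ m≤n+m _ (deg X v ∸ 2) ⟩
  (deg X v ∸ 2) + ∑[ i < k ] (deg X (punchIn v i) ∸ 2)    ≡⟨ sum-remove {i = v} (λ x → deg X x ∸ 2) ⟨
  excess X                                               ∎
  where
  open ≤-Reasoning
  deg-─-≤ : ∀ i → deg (X ─ v) i ≤ deg X (punchIn v i)
  deg-─-≤ i = ≤-trans (m≤n+m (deg (X ─ v) i) _) (≤-reflexive (sym (deg-punchIn X v i)))

m+n∸o≤m+[n∸o] : ∀ m n o → m + n ∸ o ≤ m + (n ∸ o)
m+n∸o≤m+[n∸o] m n       zero    = ≤-refl
m+n∸o≤m+[n∸o] m zero    (suc o) = m∸n≤m (m + 0) (suc o)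
m+n∸o≤m+[n∸o] m (suc n) (suc o) rewrite +-suc m n = m+n∸o≤m+[n∸o] m n o

excess-─-leaf : ∀ {k} (X : Graph (suc k)) v → deg X v ≡ 1 → excess X ≤ excess (X ─ v) + 1
excess-─-leaf {k} X v deg≡1 = begin
  excess X
    ≡⟨ sum-remove {i = v} (λ x → deg X x ∸ 2) ⟩
  (deg X v ∸ 2) + ∑[ i < k ] (deg X (punchIn v i) ∸ 2)
    ≡⟨ cong (λ d → (d ∸ 2) + ∑[ i < k ] (deg X (punchIn v i) ∸ 2)) deg≡1 ⟩
  ∑[ i < k ] (deg X (punchIn v i) ∸ 2)
    ≤⟨ sum-mono-≤ bound ⟩
  ∑[ i < k ] (𝟙 (adj X (punchIn v i) v) + (deg (X ─ v) i ∸ 2))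
    ≡⟨ ∑-distrib-+ (λ i → 𝟙 (adj X (punchIn v i) v)) (λ i → deg (X ─ v) i ∸ 2) ⟩
  ∑[ i < k ] 𝟙 (adj X (punchIn v i) v) + excess (X ─ v)
    ≡⟨ cong (_+ excess (X ─ v)) (trans (sym (deg-via-punchIn X v)) deg≡1) ⟩
  1 + excess (X ─ v)
    ≡⟨ +-comm 1 _ ⟩
  excess (X ─ v) + 1
    ∎
  where
  open ≤-Reasoning
  bound : ∀ i → deg X (punchIn v i) ∸ 2 ≤ 𝟙 (adj X (punchIn v i) v) + (deg (X ─ v) i ∸ 2)
  bound i = ≤-trans (≤-reflexive (cong (_∸ 2) (deg-punchIn X v i))) (m+n∸o≤m+[n∸o] _ (deg (X ─ v) i) 2)

degree-shift : ∀ s x y n → s + 2 * x ≡ 2 * suc n → s + 2 * y ≡ 2 * n → x ≡ suc y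
degree-shift s x y n e₁ e₂ = *-cancelˡ-≡ x (suc y) 2 (+-cancelˡ-≡ s (2 * x) (2 * suc y) (begin
  s + 2 * x       ≡⟨ e₁ ⟩
  2 * suc n       ≡⟨ *-suc 2 n ⟩
  2 + 2 * n       ≡⟨ cong (2 +_) e₂ ⟨
  2 + (s + 2 * y) ≡⟨ rearrange s y ⟩
  s + 2 * suc y   ∎))
  where
  open ≡-Reasoning
  rearrange : ∀ s y → 2 + (s + 2 * y) ≡ s + 2 * suc y
  rearrange = solve-∀

3≤?-≤-excess : ∀ d → 𝟙 (does (3 ≤? d)) ≤ d ∸ 2
3≤?-≤-excess 0                = z≤n
3≤?-≤-excess 1                = z≤n
3≤?-≤-excess 2                = z≤n
3≤?-≤-excess (suc (suc (suc d))) = s≤s z≤n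

high-or-leaf : ∀ d → 1 ≤ d → 1 ≤ 𝟙 (does (3 ≤? suc d)) + 𝟙 (does (d ≟ 1))
high-or-leaf 1             _ = ≤-refl
high-or-leaf (suc (suc d)) _ = s≤s z≤n

module Reconstruction {k} (T G : Graph (suc (suc k))) (tree : IsTree T) (uni : IsUnicyclic G)
                      {m} (w v : Fin m → Fin (suc (suc k))) (w-inj : Injective _≡_ _≡_ w) (v-inj : Injective _≡_ _≡_ v)
                      (cards : ∀ i → (G ─ w i) ≅ (T ─ v i)) where

  deg-w≡1+deg-v : ∀ i → deg G (w i) ≡ suc (deg T (v i))
  deg-w≡1+deg-v i = degree-shift (degreeSum (G ─ w i)) (deg G (w i)) (deg T (v i)) (suc k)
    (trans (sym (degreeSum-─ G (w i))) (unicyclic⇒degreeSum≡2n G uni))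
    (begin
      degreeSum (G ─ w i) + 2 * deg T (v i) ≡⟨ cong (_+ 2 * deg T (v i)) (degreeSum-≅ {X = G ─ w i} {T ─ v i} (cards i)) ⟩
      degreeSum (T ─ v i) + 2 * deg T (v i) ≡⟨ degreeSum-─ T (v i) ⟨
      degreeSum T                           ≡⟨ tree⇒degreeSum≡2k T tree ⟩
      2 * suc k                             ∎)
    where open ≡-Reasoning

  leafCount-G : leafCount G ≡ excess G
  leafCount-G = +-cancelˡ-≡ (2 * suc (suc k)) _ _
    (trans (cong (_+ leafCount G) (sym (unicyclic⇒degreeSum≡2n G uni))) (degreeSum+leafCount G (proj₁ uni)))

  leafCount-T : leafCount T ≡ 2 + excess T
  leafCount-T = +-cancelˡ-≡ (2 * suc k) _ _
    (trans (cong (_+ leafCount T) (sym (tree⇒degreeSum≡2k T tree)))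
           (trans (degreeSum+leafCount T (proj₁ tree)) (rearrange k (excess T))))
    where
    rearrange : ∀ k e → 2 * suc (suc k) + e ≡ 2 * suc k + (2 + e)
    rearrange = solve-∀

  #high-degree-cards : ∑[ i < m ] 𝟙 (does (3 ≤? deg G (w i))) ≤ leafCount G
  #high-degree-cards = begin
    ∑[ i < m ] 𝟙 (does (3 ≤? deg G (w i))) ≤⟨ sum-∘-injective-≤ (λ x → 𝟙 (does (3 ≤? deg G x))) w w-inj ⟩
    ∑[ x < suc (suc k) ] 𝟙 (does (3 ≤? deg G x)) ≤⟨ sum-mono-≤ (λ x → 3≤?-≤-excess (deg G x)) ⟩
    excess G                               ≡⟨ leafCount-G ⟨
    leafCount G                            ∎
    where open ≤-Reasoning

  #leaf-cards : ∑[ i < m ] 𝟙 (does (deg T (v i) ≟ 1)) ≤ leafCount G + 3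
  #leaf-cards with Finₚ.any? (λ i → deg T (v i) ≟ 1)
  ... | no none = ≤-trans (≤-reflexive (trans (sum-cong-≗ λ i → cong 𝟙 (dec-false (deg T (v i) ≟ 1) (none ∘ (i ,_))))
                                              (sum-replicate-zero m)))
                          z≤n
  ... | yes (i , leaf) = begin
    ∑[ i < m ] 𝟙 (does (deg T (v i) ≟ 1)) ≤⟨ sum-∘-injective-≤ (λ y → 𝟙 (does (deg T y ≟ 1))) v v-inj ⟩
    leafCount T                           ≡⟨ leafCount-T ⟩
    2 + excess T                          ≤⟨ +-monoʳ-≤ 2 (excess-─-leaf T (v i) leaf) ⟩
    2 + (excess (T ─ v i) + 1)            ≡⟨ cong (λ e → 2 + (e + 1)) (excess-≅ {X = G ─ w i} {T ─ v i} (cards i)) ⟨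
    2 + (excess (G ─ w i) + 1)            ≤⟨ +-monoʳ-≤ 2 (+-monoˡ-≤ 1 (excess-─-≤ G (w i))) ⟩
    2 + (excess G + 1)                    ≡⟨ cong (λ e → 2 + (e + 1)) leafCount-G ⟨
    2 + (leafCount G + 1)                 ≡⟨ rearrange (leafCount G) ⟩
    leafCount G + 3                       ∎
    where
    open ≤-Reasoning
    rearrange : ∀ l → 2 + (l + 1) ≡ l + 3
    rearrange = solve-∀

  m≤2·leafCount+3 : m ≤ 2 * leafCount G + 3
  m≤2·leafCount+3 = begin
    m
      ≡⟨ trans (sum-const m 1) (*-identityʳ m) ⟨
    ∑[ i < m ] 1
      ≤⟨ sum-mono-≤ every-card-counted ⟩
    ∑[ i < m ] (high i + leaf i)
      ≡⟨ ∑-distrib-+ high leaf ⟩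
    ∑[ i < m ] high i + ∑[ i < m ] leaf i
      ≤⟨ +-mono-≤ #high-degree-cards #leaf-cards ⟩
    leafCount G + (leafCount G + 3)
      ≡⟨ rearrange (leafCount G) ⟩
    2 * leafCount G + 3
      ∎
    where
    open ≤-Reasoning
    high leaf : Fin m → ℕ
    high i = 𝟙 (does (3 ≤? deg G (w i)))
    leaf i = 𝟙 (does (deg T (v i) ≟ 1))
    every-card-counted : ∀ i → 1 ≤ high i + leaf i
    every-card-counted i = subst (λ d → 1 ≤ 𝟙 (does (3 ≤? d)) + leaf i) (sym (deg-w≡1+deg-v i))
                                 (high-or-leaf (deg T (v i)) (connected⇒deg-pos T (proj₁ tree) (v i)))
    rearrange : ∀ l → l + (l + 3) ≡ 2 * l + 3
    rearrange = solve-∀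

n≤4L+4 : ∀ n m L → n / 2 + 2 ≤ m → m ≤ 2 * L + 3 → n ≤ 4 * L + 4
n≤4L+4 n m L half+2≤m m≤ = begin
  n                         ≡⟨ m≡m%n+[m/n]*n n 2 ⟩
  n % 2 + n / 2 * 2         ≤⟨ +-mono-≤ (≤-pred (m%n<n n 2)) (*-monoˡ-≤ 2 half≤) ⟩
  1 + (2 * L + 1) * 2       ≤⟨ n≤1+n _ ⟩
  suc (1 + (2 * L + 1) * 2) ≡⟨ rearrange L ⟩
  4 * L + 4                 ∎
  where
  open ≤-Reasoning
  half≤ : n / 2 ≤ 2 * L + 1
  half≤ = +-cancelʳ-≤ 2 (n / 2) (2 * L + 1) (≤-trans half+2≤m (≤-trans m≤ (≤-reflexive (sym (+-assoc (2 * L) 1 2)))))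
  rearrange : ∀ L → suc (1 + (2 * L + 1) * 2) ≡ 4 * L + 4
  rearrange = solve-∀

lemma3 : (k : ℕ) → 3 ≤ suc k → (T G : Graph (suc k)) → IsTree T → IsUnicyclic G →
         (m : ℕ) → suc k / 2 + 2 ≤ m →
         (w v : Fin m → Fin (suc k)) → Injective _≡_ _≡_ w → Injective _≡_ _≡_ v →
         (∀ i → (G ─ w i) ≅ (T ─ v i)) →
         suc k ≤ 4 * leaves G + 4
lemma3 zero    (s≤s ()) _ _ _ _ _ _ _ _ _ _ _
lemma3 (suc k) _ T G tree uni m half+2≤m w v w-inj v-inj cards =
  subst (λ L → suc (suc k) ≤ 4 * L + 4) (sym (leaves≡leafCount G))
        (n≤4L+4 (suc (suc k)) m (leafCount G) half+2≤m
                (Reconstruction.m≤2·leafCount+3 T G tree uni w v w-inj v-inj cards))
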